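{- Let $r,n$ be positive integers and $m,t\ge 2$ integers such that $(m-1)t<r<mt$. Then $$\delta(n,r,t)\le (r-1)n-\left\lceil\frac{(m-1)(r-1)n}{mt-2}\right\rceil.$$
   Context: For positive integers $n,r$, an $r$-partite graph with parts of size $n$ is a graph $G$ whose vertex set is partitioned into $r$ independent sets $V_1,\dots,V_r$, each of size $n$. $\mathcal{G}(n,r,t)$ is the family of all $r$-partite graphs with parts of size $n$ and chromatic number at most $t$, and $\delta(n,r,t):=\max\{\delta(G): G\in\mathcal{G}(n,r,t)\}$. -}

module Defs where

open import Data.Nat using (ℕ; zero; suc; _+_; _*_; _∸_; _⊓_; _/_; NonZero)
open import Data.Bool using (Bool; true; false; if_then_else_)
open import Data.Fin using (Fin)
open import Data.Product using (_×_; _,_; proj₁; Σ)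
open import Data.List using (List; []; _∷_; map; allFin; cartesianProduct; foldr)
open import Data.Nat.ListAction using (sum)
open import Relation.Binary.PropositionalEquality using (_≡_; _≢_)

-- Vertices of an r-partite graph with parts of size n: V_i = {i} × Fin n.
Vertex : ℕ → ℕ → Set
Vertex r n = Fin r × Fin n

vertices : (r n : ℕ) → List (Vertex r n)
vertices r n = cartesianProduct (allFin r) (allFin n)

record RPartiteGraph (n r : ℕ) : Set where
  field
    adj         : Vertex r n → Vertex r n → Bool
    symmetric   : ∀ u v → adj u v ≡ adj v u
    irreflexive : ∀ v → adj v v ≡ false
    partsIndependent : ∀ u v → proj₁ u ≡ proj₁ v → adj u v ≡ false
open RPartiteGraph public

ProperColouring : ∀ {n r} → RPartiteGraph n r → ℕ → Set
ProperColouring {n} {r} G t =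
  Σ (Vertex r n → Fin t) λ c → ∀ u v → adj G u v ≡ true → c u ≢ c v

ChromaticAtMost : ∀ {n r} → RPartiteGraph n r → ℕ → Set
ChromaticAtMost G t = ProperColouring G t

degree : ∀ {n r} → RPartiteGraph n r → Vertex r n → ℕ
degree {n} {r} G v = sum (map (λ w → if adj G v w then 1 else 0) (vertices r n))

-- The fold starts at
-- r * n, which is ≥ every degree, so for a nonempty vertex set this is exactly
-- the minimum (the vertex set is nonempty since r, n ≥ 1 in the theorem).
minDegreeFrom : ∀ {n r} → RPartiteGraph n r → ℕ → List (Vertex r n) → ℕ
minDegreeFrom G d [] = d
minDegreeFrom G d (v ∷ vs) = degree G v ⊓ minDegreeFrom G d vs

minDegree : ∀ {n r} → RPartiteGraph n r → ℕ
minDegree {n} {r} G = minDegreeFrom G (r * n) (vertices r n)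

-- ceiling division ⌈a / b⌉ for b ≥ 1 (value at b = 0 is an arbitrary 0;
-- never used, since b = mt − 2 ≥ 2 in the theorem)
⌈_/_⌉ : ℕ → ℕ → ℕ
⌈ a / zero ⌉ = 0
⌈ a / suc b ⌉ = (a + b) / suc b

-- Fix a proper t-colouring and write a c i for the number of vertices of
-- colour c in part i.  A vertex of colour c in part i is adjacent neither to
-- its own part nor to its own colour class, so whenever c occurs in part i the
-- number of vertices of colour c outside part i is at most x = (r-1)n - δ.
-- It remains to show (m-1)(r-1)n ≤ (mt-2)x.  If some part meets two or more
-- colours, count the (r-1)n vertices outside it by colour: a colour present in
-- the part contributes at most x, an absent one its whole class, which is at
-- most (m-1)n when the colour meets at most m-1 parts and at most m x/(m-1)
-- otherwise; if (mt-2)x < (m-1)(r-1)n these bounds add up to less than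
-- (r-1)n.  If every part is monochromatic then, as r > (m-1)t, some colour
-- fills m whole parts, so x ≥ (m-1)n, while r-1 ≤ mt-2.

module Submission where

open import Defs
open import Data.Nat using (ℕ; zero; suc; _+_; _*_; _∸_; _≤_; _<_; z≤n; s≤s; z<s; _≤?_; _<?_; >-nonZero)
open import Data.Nat.Properties hiding (_≟_)
open import Data.Nat.DivMod using (m<n*o⇒m/o<n)
open import Data.Nat.Tactic.RingSolver using (solve)
import Data.Nat.ListAction as List
open import Data.Nat.ListAction.Properties using (sum-++)
open import Data.Bool using (Bool; true; false; if_then_else_)
open import Data.Fin using (Fin; zero; suc; punchIn)
open import Data.Fin.Properties using (_≟_; all?; ¬∀⟶∃¬)
open import Data.Vec.Functional using (removeAt)
open import Data.Product using (_×_; _,_; proj₁; ∃)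
open import Data.Sum using (_⊎_; inj₁; inj₂)
open import Data.List using (List; []; _∷_; _++_; map; tabulate; allFin; cartesianProduct)
open import Data.List.Properties using (map-++; map-∘)
open import Data.List.Membership.Propositional using (_∈_)
open import Data.List.Membership.Propositional.Properties using (∈-cartesianProduct⁺; ∈-allFin)
open import Data.List.Relation.Unary.Any using (here; there)
open import Relation.Nullary using (¬_; yes; no; does; contradiction)
open import Relation.Binary.PropositionalEquality
open import Function using (_∘_; id)
open import Algebra.Properties.CommutativeMonoid.Sum +-0-commutativeMonoid
  using (sum; sum-syntax; sum-cong-≗; sum-remove; sum-replicate-zero; ∑-distrib-+; ∑-comm)
open import Algebra.Properties.Semiring.Sum +-*-semiring
  using (*-distribˡ-sum; *-distribʳ-sum)

∑-mono-≤ : ∀ {n} {f g : Fin n → ℕ} → (∀ i → f i ≤ g i) → sum f ≤ sum g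
∑-mono-≤ {zero}  f≤g = z≤n
∑-mono-≤ {suc n} f≤g = +-mono-≤ (f≤g zero) (∑-mono-≤ (f≤g ∘ suc))

∑-const : ∀ n c → ∑[ i < n ] c ≡ n * c
∑-const zero    c = refl
∑-const (suc n) c = cong (c +_) (∑-const n c)

∑-ones : ∀ n → ∑[ i < n ] 1 ≡ n
∑-ones n = trans (∑-const n 1) (*-identityʳ n)

term≤∑ : ∀ {n} (f : Fin n → ℕ) i → f i ≤ sum f
term≤∑ {suc n} f i = subst (f i ≤_) (sym (sum-remove f)) (m≤m+n (f i) _)

∑-pigeonhole : ∀ {n} (f : Fin n → ℕ) m → n * m < sum f → ∃ λ i → m < f i
∑-pigeonhole {zero}  f m ()
∑-pigeonhole {suc n} f m n*m<∑ with m <? f zero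
... | yes m<f₀ = zero , m<f₀
... | no  m≮f₀ with ∑-pigeonhole (f ∘ suc) m
      (+-cancelˡ-< m _ _ (<-≤-trans n*m<∑ (+-monoˡ-≤ _ (≮⇒≥ m≮f₀))))
...   | i , m<fᵢ = suc i , m<fᵢ

∑-pos⇒pos : ∀ {n} (f : Fin n → ℕ) → 0 < sum f → ∃ λ i → 0 < f i
∑-pos⇒pos {n} f 0<∑ = ∑-pigeonhole f 0 (subst (_< sum f) (sym (*-zeroʳ n)) 0<∑)

sgn : ℕ → ℕ
sgn zero    = 0
sgn (suc _) = 1

sgn-pos⇒pos : ∀ {m} → 0 < sgn m → 0 < m
sgn-pos⇒pos {suc m} _ = z<s

pos⇒sgn-pos : ∀ {m} → 0 < m → 0 < sgn m
pos⇒sgn-pos {suc m} _ = z<s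

sgn*-≤ : ∀ m {n} → (0 < m → n ≤ m) → sgn m * n ≤ m
sgn*-≤ zero    _   = z≤n
sgn*-≤ (suc m) n≤m = ≤-trans (≤-reflexive (*-identityˡ _)) (n≤m z<s)

≤-sgn* : ∀ {m n} → m ≤ n → m ≤ sgn m * n
≤-sgn* {zero}  _   = z≤n
≤-sgn* {suc m} m≤n = ≤-trans m≤n (≤-reflexive (sym (*-identityˡ _)))

-- The indicator sgn m lets a bound that depends on whether m vanishes be
-- summed without case distinctions and without truncated subtraction.
≤-by-sgn : ∀ m {y z p} → (m ≡ 0 → y ≤ p) → (0 < m → y ≤ z) →
           y + sgn m * p ≤ sgn m * z + p
≤-by-sgn zero    {y} y≤p _   = ≤-trans (≤-reflexive (+-identityʳ y)) (y≤p refl)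
≤-by-sgn (suc m) {y} {z} {p} _ y≤z = begin
  y + 1 * p  ≤⟨ +-monoˡ-≤ (1 * p) (y≤z z<s) ⟩
  z + 1 * p  ≡⟨ cong₂ _+_ (sym (*-identityˡ z)) (*-identityˡ p) ⟩
  1 * z + p  ∎
  where open ≤-Reasoning

≤-sgn*-+ : ∀ m {y x} → (0 < m → y ≤ x + m) → y * sgn m ≤ x * sgn m + m
≤-sgn*-+ zero    {y} {x} _ = subst (_≤ x * 0 + 0) (sym (*-zeroʳ y)) z≤n
≤-sgn*-+ (suc m) {y} {x} y≤x+m =
  subst₂ _≤_ (sym (*-identityʳ y)) (cong (_+ suc m) (sym (*-identityʳ x))) (y≤x+m z<s)

∑-sgn≡0⇒∑≡0 : ∀ {n} (f : Fin n → ℕ) → ∑[ i < n ] sgn (f i) ≡ 0 → sum f ≡ 0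
∑-sgn≡0⇒∑≡0 {zero}  f _ = refl
∑-sgn≡0⇒∑≡0 {suc n} f ∑sgn≡0 with f zero
... | zero  = ∑-sgn≡0⇒∑≡0 (f ∘ suc) ∑sgn≡0
... | suc _ = contradiction ∑sgn≡0 λ ()

∑-single-support : ∀ {n} (f : Fin n → ℕ) → ∑[ i < n ] sgn (f i) ≤ 1 →
                   ∀ i → 0 < f i → sum f ≡ f i
∑-single-support {suc n} f ∑sgn≤1 i 0<fᵢ = begin-equality
  sum f                       ≡⟨ sum-remove f ⟩
  f i + sum (removeAt f i)    ≡⟨ cong (f i +_) (∑-sgn≡0⇒∑≡0 (removeAt f i) rest≡0) ⟩
  f i + 0                     ≡⟨ +-identityʳ (f i) ⟩
  f i                         ∎
  where
  open ≤-Reasoning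
  rest≡0 : sum (sgn ∘ removeAt f i) ≡ 0
  rest≡0 = n≤0⇒n≡0 (+-cancelˡ-≤ 1 _ 0 (begin
    1 + sum (sgn ∘ removeAt f i)    ≤⟨ +-monoˡ-≤ _ (pos⇒sgn-pos 0<fᵢ) ⟩
    sgn (f i) + sum (sgn ∘ removeAt f i)  ≡⟨ sum-remove (sgn ∘ f) ⟨
    sum (sgn ∘ f)                   ≤⟨ ∑sgn≤1 ⟩
    1                               ∎))

-- (k - 1) c ≤ k x with k ≥ m + 1 gives c ≤ (m + 1) x / m; multiplying through
-- by k first keeps every step subtraction-free.
m*c≤[1+m]*x : ∀ {m k c x} → suc m ≤ k → c * k ≤ x * k + c → m * c ≤ suc m * x
m*c≤[1+m]*x {m} {k} {c} {x} 1+m≤k ck≤xk+c =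
  +-cancelʳ-≤ c _ _ (subst (_≤ suc m * x + c) (+-comm c (m * c))
    (*-cancelˡ-≤ k {{>-nonZero (<-≤-trans z<s 1+m≤k)}} scaled))
  where
  open ≤-Reasoning
  scaled : k * (suc m * c) ≤ k * (suc m * x + c)
  scaled = begin
    k * (suc m * c)            ≡⟨ solve (k ∷ m ∷ c ∷ []) ⟩
    suc m * (c * k)            ≤⟨ *-monoʳ-≤ (suc m) ck≤xk+c ⟩
    suc m * (x * k + c)        ≡⟨ *-distribˡ-+ (suc m) (x * k) c ⟩
    suc m * (x * k) + suc m * c  ≤⟨ +-monoʳ-≤ (suc m * (x * k)) (*-monoˡ-≤ c 1+m≤k) ⟩
    suc m * (x * k) + k * c    ≡⟨ solve (k ∷ m ∷ x ∷ c ∷ []) ⟩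
    k * (suc m * x + c)        ∎

D*m≤[1+m]*r : ∀ {m t r D} → m * t ≤ r → D + 2 ≡ suc m * t → D * m ≤ suc m * r
D*m≤[1+m]*r {m} {t} {r} {D} mt≤r D+2≡ = begin
  D * m            ≤⟨ *-monoˡ-≤ m (m≤m+n D 2) ⟩
  (D + 2) * m      ≡⟨ cong (_* m) D+2≡ ⟩
  suc m * t * m    ≡⟨ solve (m ∷ t ∷ []) ⟩
  suc m * (m * t)  ≤⟨ *-monoʳ-≤ (suc m) mt≤r ⟩
  suc m * r        ∎
  where open ≤-Reasoning

r≤D : ∀ {m t r D} → suc r < suc m * t → D + 2 ≡ suc m * t → r ≤ D
r≤D {r = r} {D} 1+r<[1+m]t D+2≡ =
  +-cancelˡ-≤ 2 r D (subst (2 + r ≤_) (trans (sym D+2≡) (+-comm D 2)) 1+r<[1+m]t)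

multicolour-impossible : ∀ {m t d D y A} → 1 ≤ m → 2 ≤ d → y < A → D + 2 ≡ suc m * t →
  ¬ (D * A + d * (suc m * A) ≤ d * (m * y) + t * (suc m * A))
multicolour-impossible {m} {t} {d} {D} {y} {A} 1≤m 2≤d y<A D+2≡ counted =
  <⇒≱ (*-cancelʳ-< A d 2 (+-cancelˡ-< (d * (m * A)) _ _ dmA+dA<dmA+2A)) 2≤d
  where
  open ≤-Reasoning
  rhs≡ : d * (m * y) + t * (suc m * A) ≡ D * A + (d * (m * y) + 2 * A)
  rhs≡ = begin-equality
    d * (m * y) + t * (suc m * A)  ≡⟨ cong (d * (m * y) +_) (solve (t ∷ m ∷ A ∷ [])) ⟩
    d * (m * y) + suc m * t * A    ≡⟨ cong (λ z → d * (m * y) + z * A) (sym D+2≡) ⟩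
    d * (m * y) + (D + 2) * A      ≡⟨ solve (d ∷ m ∷ y ∷ D ∷ A ∷ []) ⟩
    D * A + (d * (m * y) + 2 * A)  ∎
  dmA+dA<dmA+2A : d * (m * A) + d * A < d * (m * A) + 2 * A
  dmA+dA<dmA+2A = begin-strict
    d * (m * A) + d * A  ≡⟨ solve (d ∷ m ∷ A ∷ []) ⟩
    d * (suc m * A)      ≤⟨ +-cancelˡ-≤ (D * A) _ _ (≤-trans counted (≤-reflexive rhs≡)) ⟩
    d * (m * y) + 2 * A  <⟨ +-monoˡ-< (2 * A) (*-monoʳ-< d {{>-nonZero (<-≤-trans z<s 2≤d)}}
                                         (*-monoʳ-< m {{>-nonZero 1≤m}} y<A)) ⟩
    d * (m * A) + 2 * A  ∎

-- The parts are indexed by Fin (suc r), so r here is the r - 1 of the statement.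
module ColourProfile {t r n : ℕ} (a : Fin t → Fin (suc r) → ℕ)
                     (column-sum : ∀ i → ∑[ c < t ] a c i ≡ n) where

  size : Fin t → ℕ
  size c = sum (a c)

  others : Fin t → Fin (suc r) → ℕ
  others c i = sum (removeAt (a c) i)

  spread : Fin t → ℕ
  spread c = ∑[ i < suc r ] sgn (a c i)

  colours : Fin (suc r) → ℕ
  colours i = ∑[ c < t ] sgn (a c i)

  size≡cell+others : ∀ c i → size c ≡ a c i + others c i
  size≡cell+others c i = sum-remove (a c)

  others≡size : ∀ c i → a c i ≡ 0 → others c i ≡ size c
  others≡size c i a≡0 = sym (trans (size≡cell+others c i) (cong (_+ others c i) a≡0))

  cell≤n : ∀ c i → a c i ≤ n
  cell≤n c i = subst (a c i ≤_) (column-sum i) (term≤∑ (λ c → a c i) c)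

  ∑-others : ∀ j → ∑[ c < t ] others c j ≡ r * n
  ∑-others j = begin
    ∑[ c < t ] ∑[ i < r ] a c (punchIn j i)  ≡⟨ ∑-comm (λ c i → a c (punchIn j i)) ⟩
    ∑[ i < r ] ∑[ c < t ] a c (punchIn j i)  ≡⟨ sum-cong-≗ (column-sum ∘ punchIn j) ⟩
    ∑[ i < r ] n                             ≡⟨ ∑-const r n ⟩
    r * n                                    ∎
    where open ≡-Reasoning

  size≤spread*n : ∀ c → size c ≤ spread c * n
  size≤spread*n c = begin
    size c                            ≤⟨ ∑-mono-≤ (λ i → ≤-sgn* (cell≤n c i)) ⟩
    ∑[ i < suc r ] (sgn (a c i) * n)  ≡⟨ *-distribʳ-sum n (λ i → sgn (a c i)) ⟨
    spread c * n                      ∎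
    where open ≤-Reasoning

  ∑-spread≡∑-colours : ∑[ c < t ] spread c ≡ ∑[ i < suc r ] colours i
  ∑-spread≡∑-colours = ∑-comm (λ c i → sgn (a c i))

  occupied-part : ∀ c → 0 < spread c → ∃ λ i → 0 < a c i
  occupied-part c 0<spread with ∑-pos⇒pos (λ i → sgn (a c i)) 0<spread
  ... | i , 0<sgn = i , sgn-pos⇒pos 0<sgn

  colours-pos : 0 < n → ∀ i → 0 < colours i
  colours-pos 0<n i with ∑-pos⇒pos (λ c → a c i) (subst (0 <_) (sym (column-sum i)) 0<n)
  ... | c , 0<a = <-≤-trans (pos⇒sgn-pos 0<a) (term≤∑ (λ c → sgn (a c i)) c)

  -- Pigeonhole: the t colours together meet at least r + 1 parts.
  widespread-colour : ∀ {m} → 0 < n → m * t < suc r → ∃ λ c → m < spread c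
  widespread-colour {m} 0<n mt<1+r = ∑-pigeonhole spread m (begin-strict
    t * m                     ≡⟨ *-comm t m ⟩
    m * t                     <⟨ mt<1+r ⟩
    suc r                     ≡⟨ ∑-ones (suc r) ⟨
    ∑[ i < suc r ] 1          ≤⟨ ∑-mono-≤ (colours-pos 0<n) ⟩
    ∑[ i < suc r ] colours i  ≡⟨ ∑-spread≡∑-colours ⟨
    ∑[ c < t ] spread c       ∎)
    where open ≤-Reasoning

  module _ (colours≤1 : ∀ i → colours i ≤ 1) where

    monochromatic-full : ∀ c i → 0 < a c i → n ≤ a c i
    monochromatic-full c i 0<a = ≤-reflexive
      (trans (sym (column-sum i)) (∑-single-support (λ c → a c i) (colours≤1 i) c 0<a))

    others-of-widespread : ∀ m c i → m < spread c → 0 < a c i → m * n ≤ others c i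
    others-of-widespread m c i m<spread 0<a = +-cancelˡ-≤ n _ _ (begin
      suc m * n                         ≤⟨ *-monoˡ-≤ n m<spread ⟩
      spread c * n                      ≡⟨ *-distribʳ-sum n (λ i → sgn (a c i)) ⟩
      ∑[ i < suc r ] (sgn (a c i) * n)  ≤⟨ ∑-mono-≤ (λ i → sgn*-≤ (a c i) (monochromatic-full c i)) ⟩
      size c                            ≡⟨ size≡cell+others c i ⟩
      a c i + others c i                ≤⟨ +-monoˡ-≤ (others c i) (cell≤n c i) ⟩
      n + others c i                    ∎)
      where open ≤-Reasoning

  module _ (x : ℕ) (others≤x : ∀ c i → 0 < a c i → others c i ≤ x) where

    size≤x+cell : ∀ c i → 0 < a c i → size c ≤ x + a c i
    size≤x+cell c i 0<a = begin
      size c              ≡⟨ size≡cell+others c i ⟩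
      a c i + others c i  ≤⟨ +-monoʳ-≤ (a c i) (others≤x c i 0<a) ⟩
      a c i + x           ≡⟨ +-comm (a c i) x ⟩
      x + a c i           ∎
      where open ≤-Reasoning

    size*spread≤x*spread+size : ∀ c → size c * spread c ≤ x * spread c + size c
    size*spread≤x*spread+size c = begin
      size c * spread c                                  ≡⟨ *-distribˡ-sum (size c) (λ i → sgn (a c i)) ⟩
      ∑[ i < suc r ] (size c * sgn (a c i))              ≤⟨ ∑-mono-≤ (λ i → ≤-sgn*-+ (a c i) (size≤x+cell c i)) ⟩
      ∑[ i < suc r ] (x * sgn (a c i) + a c i)           ≡⟨ ∑-distrib-+ (λ i → x * sgn (a c i)) (a c) ⟩
      ∑[ i < suc r ] (x * sgn (a c i)) + size c          ≡⟨ cong (_+ size c) (*-distribˡ-sum x (λ i → sgn (a c i))) ⟨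
      x * spread c + size c                              ∎
      where open ≤-Reasoning

    small-or-spread-out : ∀ m c → size c ≤ m * n ⊎ m * size c ≤ suc m * x
    small-or-spread-out m c with spread c ≤? m
    ... | yes spread≤m = inj₁ (≤-trans (size≤spread*n c) (*-monoˡ-≤ n spread≤m))
    ... | no  spread≰m = inj₂ (m*c≤[1+m]*x (≰⇒> spread≰m) (size*spread≤x*spread+size c))

    module _ {M D : ℕ} (1≤M : 1 ≤ M) (Mt<1+r : M * t < suc r)
             (1+r<[1+M]t : suc r < suc M * t) (D+2≡ : D + 2 ≡ suc M * t) where

      absent-colour-bound : ∀ c j → a c j ≡ 0 → D * x < M * r * n →
                            D * (M * others c j) ≤ suc M * (M * r * n)
      absent-colour-bound c j a≡0 Dx<A with small-or-spread-out M c
      ... | inj₁ small = begin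
        D * (M * others c j)   ≡⟨ cong (λ z → D * (M * z)) (others≡size c j a≡0) ⟩
        D * (M * size c)       ≤⟨ *-monoʳ-≤ D (*-monoʳ-≤ M small) ⟩
        D * (M * (M * n))      ≡⟨ solve (D ∷ M ∷ n ∷ []) ⟩
        D * M * (M * n)        ≤⟨ *-monoˡ-≤ (M * n) (D*m≤[1+m]*r (≤-pred Mt<1+r) D+2≡) ⟩
        suc M * r * (M * n)    ≡⟨ solve (M ∷ r ∷ n ∷ []) ⟩
        suc M * (M * r * n)    ∎
        where open ≤-Reasoning
      ... | inj₂ spread-out = begin
        D * (M * others c j)   ≡⟨ cong (λ z → D * (M * z)) (others≡size c j a≡0) ⟩
        D * (M * size c)       ≤⟨ *-monoʳ-≤ D spread-out ⟩
        D * (suc M * x)        ≡⟨ solve (D ∷ M ∷ x ∷ []) ⟩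
        suc M * (D * x)        ≤⟨ *-monoʳ-≤ (suc M) (<⇒≤ Dx<A) ⟩
        suc M * (M * r * n)    ∎
        where open ≤-Reasoning

      -- Count the r n vertices outside part j by colour.
      multicoloured-part : ∀ j → 2 ≤ colours j → M * r * n ≤ D * x
      multicoloured-part j 2≤colours = ≮⇒≥ λ Dx<A →
        multicolour-impossible 1≤M 2≤colours Dx<A D+2≡ (counted Dx<A)
        where
        open ≤-Reasoning
        A P Q : ℕ
        A = M * r * n
        P = suc M * A
        Q = M * (D * x)
        lhs≡ : D * A ≡ ∑[ c < t ] (D * (M * others c j))
        lhs≡ = begin-equality
          D * (M * r * n)                   ≡⟨ cong (D *_) (*-assoc M r n) ⟩
          D * (M * (r * n))                 ≡⟨ cong (λ z → D * (M * z)) (∑-others j) ⟨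
          D * (M * ∑[ c < t ] others c j)   ≡⟨ cong (D *_) (*-distribˡ-sum M (λ c → others c j)) ⟩
          D * ∑[ c < t ] (M * others c j)   ≡⟨ *-distribˡ-sum D (λ c → M * others c j) ⟩
          ∑[ c < t ] (D * (M * others c j)) ∎
        present-colour-bound : ∀ c → 0 < a c j → D * (M * others c j) ≤ Q
        present-colour-bound c 0<a = begin
          D * (M * others c j)  ≤⟨ *-monoʳ-≤ D (*-monoʳ-≤ M (others≤x c j 0<a)) ⟩
          D * (M * x)           ≡⟨ solve (D ∷ M ∷ x ∷ []) ⟩
          M * (D * x)           ∎
        counted : D * x < A → D * A + colours j * P ≤ colours j * Q + t * P
        counted Dx<A = begin
          D * A + colours j * P
            ≡⟨ cong₂ _+_ lhs≡ (*-distribʳ-sum P (λ c → sgn (a c j))) ⟩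
          ∑[ c < t ] (D * (M * others c j)) + ∑[ c < t ] (sgn (a c j) * P)
            ≡⟨ ∑-distrib-+ (λ c → D * (M * others c j)) (λ c → sgn (a c j) * P) ⟨
          ∑[ c < t ] (D * (M * others c j) + sgn (a c j) * P)
            ≤⟨ ∑-mono-≤ (λ c → ≤-by-sgn (a c j)
                 (λ a≡0 → absent-colour-bound c j a≡0 Dx<A) (present-colour-bound c)) ⟩
          ∑[ c < t ] (sgn (a c j) * Q + P)
            ≡⟨ ∑-distrib-+ (λ c → sgn (a c j) * Q) (λ _ → P) ⟩
          ∑[ c < t ] (sgn (a c j) * Q) + ∑[ c < t ] P
            ≡⟨ cong₂ _+_ (sym (*-distribʳ-sum Q (λ c → sgn (a c j)))) (∑-const t P) ⟩
          colours j * Q + t * P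
            ∎

      monochromatic-parts : 0 < n → (∀ i → colours i ≤ 1) → M * r * n ≤ D * x
      monochromatic-parts 0<n colours≤1 with widespread-colour 0<n Mt<1+r
      ... | c , M<spread with occupied-part c (≤-<-trans z≤n M<spread)
      ...   | i , 0<a = begin
        M * r * n    ≡⟨ solve (M ∷ r ∷ n ∷ []) ⟩
        r * (M * n)  ≤⟨ *-monoˡ-≤ (M * n) (r≤D {M} {t} 1+r<[1+M]t D+2≡) ⟩
        D * (M * n)  ≤⟨ *-monoʳ-≤ D (others-of-widespread colours≤1 M c i M<spread 0<a) ⟩
        D * others c i  ≤⟨ *-monoʳ-≤ D (others≤x c i 0<a) ⟩
        D * x        ∎
        where open ≤-Reasoning

      profile-bound : 0 < n → M * r * n ≤ D * x
      profile-bound 0<n with all? (λ i → colours i ≤? 1)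
      ... | yes colours≤1 = monochromatic-parts 0<n colours≤1
      ... | no ¬colours≤1 with ¬∀⟶∃¬ (suc r) _ (λ i → colours i ≤? 1) ¬colours≤1
      ...   | j , colours≰1 = multicoloured-part j (≰⇒> colours≰1)

indicator : Bool → ℕ
indicator b = if b then 1 else 0

indicator≤1 : ∀ b → indicator b ≤ 1
indicator≤1 true  = ≤-refl
indicator≤1 false = z≤n

∑-indicator-≟ : ∀ {t} (c₀ : Fin t) → ∑[ c < t ] indicator (does (c₀ ≟ c)) ≡ 1
∑-indicator-≟ {suc t} zero     = cong suc (sum-replicate-zero t)
∑-indicator-≟ {suc t} (suc c₀) = ∑-indicator-≟ c₀

sum-map-tabulate : ∀ {A : Set} {n} (f : A → ℕ) (g : Fin n → A) →
                   List.sum (map f (tabulate g)) ≡ ∑[ i < n ] f (g i)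
sum-map-tabulate {n = zero}  f g = refl
sum-map-tabulate {n = suc n} f g = cong (f (g zero) +_) (sum-map-tabulate f (g ∘ suc))

sum-map-cartesianProduct : ∀ {A B : Set} (f : A × B → ℕ) (xs : List A) (ys : List B) →
  List.sum (map f (cartesianProduct xs ys)) ≡ List.sum (map (λ x → List.sum (map (λ y → f (x , y)) ys)) xs)
sum-map-cartesianProduct f []       ys = refl
sum-map-cartesianProduct f (x ∷ xs) ys = begin
  List.sum (map f (map (x ,_) ys ++ cartesianProduct xs ys))
    ≡⟨ cong List.sum (map-++ f (map (x ,_) ys) _) ⟩
  List.sum (map f (map (x ,_) ys) ++ map f (cartesianProduct xs ys))
    ≡⟨ sum-++ (map f (map (x ,_) ys)) _ ⟩
  List.sum (map f (map (x ,_) ys)) + List.sum (map f (cartesianProduct xs ys))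
    ≡⟨ cong₂ _+_ (cong List.sum (sym (map-∘ ys))) (sum-map-cartesianProduct f xs ys) ⟩
  List.sum (map (λ y → f (x , y)) ys) + List.sum (map (λ x → List.sum (map (λ y → f (x , y)) ys)) xs)
    ∎
  where open ≡-Reasoning

sum-map-vertices : ∀ {r n} (f : Vertex r n → ℕ) →
                   List.sum (map f (vertices r n)) ≡ ∑[ i < r ] ∑[ k < n ] f (i , k)
sum-map-vertices {r} {n} f = begin
  List.sum (map f (cartesianProduct (allFin r) (allFin n)))
    ≡⟨ sum-map-cartesianProduct f (allFin r) (allFin n) ⟩
  List.sum (map (λ i → List.sum (map (λ k → f (i , k)) (allFin n))) (allFin r))
    ≡⟨ sum-map-tabulate (λ i → List.sum (map (λ k → f (i , k)) (allFin n))) id ⟩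
  ∑[ i < r ] List.sum (map (λ k → f (i , k)) (allFin n))
    ≡⟨ sum-cong-≗ (λ i → sum-map-tabulate (λ k → f (i , k)) id) ⟩
  ∑[ i < r ] ∑[ k < n ] f (i , k)
    ∎
  where open ≡-Reasoning

module Coloured {n r t} (G : RPartiteGraph n (suc r)) (col : Vertex (suc r) n → Fin t)
                (proper : ∀ u v → adj G u v ≡ true → col u ≢ col v) where

  classSize : Fin t → Fin (suc r) → ℕ
  classSize c i = ∑[ k < n ] indicator (does (col (i , k) ≟ c))

  classSize-column : ∀ i → ∑[ c < t ] classSize c i ≡ n
  classSize-column i = begin
    ∑[ c < t ] ∑[ k < n ] indicator (does (col (i , k) ≟ c))  ≡⟨ ∑-comm (λ c k → indicator (does (col (i , k) ≟ c))) ⟩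
    ∑[ k < n ] ∑[ c < t ] indicator (does (col (i , k) ≟ c))  ≡⟨ sum-cong-≗ (λ k → ∑-indicator-≟ (col (i , k))) ⟩
    ∑[ k < n ] 1                                              ≡⟨ ∑-ones n ⟩
    n                                                         ∎
    where open ≡-Reasoning

  open ColourProfile classSize classSize-column public

  adjacent-or-same-colour≤1 : ∀ v w → indicator (adj G v w) + indicator (does (col w ≟ col v)) ≤ 1
  adjacent-or-same-colour≤1 v w with adj G v w in v~w | col w ≟ col v
  ... | true  | yes same = contradiction (sym same) (proper v w v~w)
  ... | true  | no  _    = ≤-refl
  ... | false | c?       = indicator≤1 (does c?)

  degree+others≤ : ∀ v → degree G v + others (col v) (proj₁ v) ≤ r * n
  degree+others≤ v@(p , _) = begin
    degree G v + others c p
      ≡⟨ cong (_+ others c p) (trans (sum-map-vertices (indicator ∘ adj G v)) (sum-remove E)) ⟩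
    E p + ∑[ i < r ] E (punchIn p i) + others c p
      ≡⟨ cong (λ z → z + ∑[ i < r ] E (punchIn p i) + others c p) Ep≡0 ⟩
    ∑[ i < r ] E (punchIn p i) + ∑[ i < r ] classSize c (punchIn p i)
      ≡⟨ ∑-distrib-+ (E ∘ punchIn p) (classSize c ∘ punchIn p) ⟨
    ∑[ i < r ] (E (punchIn p i) + classSize c (punchIn p i))
      ≡⟨ sum-cong-≗ (λ i → ∑-distrib-+ (λ k → indicator (adj G v (punchIn p i , k))) _) ⟨
    ∑[ i < r ] ∑[ k < n ] (indicator (adj G v (punchIn p i , k)) + indicator (does (col (punchIn p i , k) ≟ c)))
      ≤⟨ ∑-mono-≤ (λ i → ∑-mono-≤ (λ k → adjacent-or-same-colour≤1 v (punchIn p i , k))) ⟩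
    ∑[ i < r ] ∑[ k < n ] 1
      ≡⟨ sum-cong-≗ {r} (λ _ → ∑-ones n) ⟩
    ∑[ i < r ] n
      ≡⟨ ∑-const r n ⟩
    r * n
      ∎
    where
    open ≤-Reasoning
    c : Fin t
    c = col v
    E : Fin (suc r) → ℕ
    E i = ∑[ k < n ] indicator (adj G v (i , k))
    Ep≡0 : E p ≡ 0
    Ep≡0 = trans (sum-cong-≗ (λ k → cong indicator (partsIndependent G v (p , k) refl)))
                 (sum-replicate-zero n)

  cell-witness : ∀ c i → 0 < classSize c i → ∃ λ k → col (i , k) ≡ c
  cell-witness c i 0<a with ∑-pos⇒pos _ 0<a
  ... | k , 0<[k] with col (i , k) ≟ c
  ...   | yes same = k , same
  cell-witness c i 0<a | k , () | no _

minDegreeFrom≤degree : ∀ {n r} (G : RPartiteGraph n r) d {vs} {v} → v ∈ vs → minDegreeFrom G d vs ≤ degree G v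
minDegreeFrom≤degree G d (here refl) = m⊓n≤m _ _
minDegreeFrom≤degree G d (there v∈vs) = ≤-trans (m⊓n≤n _ _) (minDegreeFrom≤degree G d v∈vs)

minDegree≤degree : ∀ {n r} (G : RPartiteGraph n r) v → minDegree G ≤ degree G v
minDegree≤degree {n} {r} G (i , k) =
  minDegreeFrom≤degree G (r * n) (∈-cartesianProduct⁺ (∈-allFin i) (∈-allFin k))

⌈/⌉≤ : ∀ {a d x} → a ≤ d * x → ⌈ a / d ⌉ ≤ x
⌈/⌉≤ {d = zero}            _     = z≤n
⌈/⌉≤ {a} {d = suc b} {x} a≤dx = ≤-pred (m<n*o⇒m/o<n (begin-strict
  a + b          <⟨ +-monoʳ-< a (n<1+n b) ⟩
  a + suc b      ≤⟨ +-monoˡ-≤ (suc b) (≤-trans a≤dx (≤-reflexive (*-comm (suc b) x))) ⟩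
  x * suc b + suc b  ≡⟨ +-comm (x * suc b) (suc b) ⟩
  suc x * suc b  ∎))
  where open ≤-Reasoning

≤-∸-⌈/⌉ : ∀ {δ N a d} → δ ≤ N → a ≤ d * (N ∸ δ) → δ ≤ N ∸ ⌈ a / d ⌉
≤-∸-⌈/⌉ {δ} {N} {a} {d} δ≤N a≤d[N∸δ] = begin
  δ              ≡⟨ m∸[m∸n]≡n δ≤N ⟨
  N ∸ (N ∸ δ)    ≤⟨ ∸-monoʳ-≤ N (⌈/⌉≤ {a} {d} a≤d[N∸δ]) ⟩
  N ∸ ⌈ a / d ⌉  ∎
  where open ≤-Reasoning

proposition5p1 : (r n m t : ℕ) → 1 ≤ r → 1 ≤ n → 2 ≤ m → 2 ≤ t →
    (m ∸ 1) * t < r → r < m * t →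
    (G : RPartiteGraph n r) → ChromaticAtMost G t →
    minDegree G ≤ (r ∸ 1) * n ∸ ⌈ (m ∸ 1) * (r ∸ 1) * n / (m * t ∸ 2) ⌉
proposition5p1 (suc r) (suc n) (suc M) t _ _ (s≤s 1≤M) 2≤t Mt<1+r 1+r<[1+M]t G (col , proper) =
  ≤-∸-⌈/⌉ {d = suc M * t ∸ 2} δ≤rn (profile-bound x others≤x 1≤M Mt<1+r 1+r<[1+M]t D+2≡ z<s)
  where
  open Coloured G col proper
  x : ℕ
  x = r * suc n ∸ minDegree G
  δ≤rn : minDegree G ≤ r * suc n
  δ≤rn = ≤-trans (minDegree≤degree G (zero , zero)) (m+n≤o⇒m≤o _ (degree+others≤ (zero , zero)))
  others≤x : ∀ c i → 0 < classSize c i → others c i ≤ x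
  others≤x c i 0<a with cell-witness c i 0<a
  ... | k , refl = ≤-trans
    (m+n≤o⇒m≤o∸n _ (subst (_≤ r * suc n) (+-comm (degree G (i , k)) _) (degree+others≤ (i , k))))
    (∸-monoʳ-≤ (r * suc n) (minDegree≤degree G (i , k)))
  D+2≡ : suc M * t ∸ 2 + 2 ≡ suc M * t
  D+2≡ = m∸n+n≡m (≤-trans 2≤t (m≤n*m t (suc M)))
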